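{- For all odd integers $j\ge1$, $a_{j+2}\ge1$ and every even integer $a_{j+1}\ge2$, the tree $RT(0^j,a_{j+1},a_{j+2})$ is super edge-graceful.
   Context: For a finite simple graph $G$ with $p$ vertices and $q$ edges, $G$ is super edge-graceful if there is a bijection $f$ from $E(G)$ onto $\{0,\pm1,\ldots,\pm\frac{q-1}{2}\}$ when $q$ is odd, and onto $\{\pm1,\ldots,\pm\frac{q}{2}\}$ when $q$ is even, such that the induced vertex labeling $f^+(v)=\sum_{uv\in E(G)} f(uv)$ is a bijection from $V(G)$ onto $\{0,\pm1,\ldots,\pm\frac{p-1}{2}\}$ when $p$ is odd, and onto $\{\pm1,\ldots,\pm\frac{p}{2}\}$ when $p$ is even. $RT(0^j,a,b)$ denotes the rooted tree with root $v_0$ having $j+2$ children: $j$ of them are leaves, one has exactly $a$ children (all leaves) and one has exactly $b$ children (all leaves). -}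

module Defs where

open import Data.Nat as ℕ using (ℕ; zero; suc; _+_; _<ᵇ_)
open import Data.Nat.Divisibility using (_∣_)
open import Data.Nat.DivMod using (_/_)
open import Data.Integer as ℤ using (ℤ; ∣_∣)
open import Data.Fin as Fin using (Fin; toℕ)
open import Data.Bool using (Bool; true; false; if_then_else_; _∨_)
open import Data.Product using (_×_; _,_; proj₁; proj₂; ∃)
open import Relation.Nullary using (¬_; does)
open import Relation.Binary.PropositionalEquality using (_≡_; _≢_)
open import Function.Definitions using (Injective)

record Graph : Set where
  field
    p    : ℕ
    q    : ℕ
    ends : Fin q → Fin p × Fin p
open Graph public

∑ : (n : ℕ) → (Fin n → ℤ) → ℤ
∑ zero    g = ℤ.0ℤ
∑ (suc n) g = g Fin.zero ℤ.+ ∑ n (λ i → g (Fin.suc i))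

Even : ℕ → Set
Even n = 2 ∣ n

Odd : ℕ → Set
Odd n = ¬ (2 ∣ n)

-- The label set for n elements:
--   n odd : {0, ±1, …, ±(n-1)/2}
--   n even: {±1, …, ±n/2}
-- (for odd n, n / 2 = (n-1)/2 with floor division)
InLabels : ℕ → ℤ → Set
InLabels n z = (∣ z ∣ ℕ.≤ n / 2) × (Even n → z ≢ ℤ.0ℤ)

IsBijOnto : {m : ℕ} → (Fin m → ℤ) → ℕ → Set
IsBijOnto g n =
  (∀ x → InLabels n (g x)) ×
  Injective _≡_ _≡_ g ×
  (∀ z → InLabels n z → ∃ λ x → g x ≡ z)

incident : (G : Graph) → Fin (q G) → Fin (p G) → Bool
incident G e v = does (proj₁ (ends G e) Fin.≟ v) ∨ does (proj₂ (ends G e) Fin.≟ v)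

induced : (G : Graph) → (Fin (q G) → ℤ) → Fin (p G) → ℤ
induced G f v = ∑ (q G) (λ e → if incident G e v then f e else ℤ.0ℤ)

SuperEdgeGraceful : Graph → Set
SuperEdgeGraceful G =
  ∃ λ (f : Fin (q G) → ℤ) → IsBijOnto f (q G) × IsBijOnto (induced G f) (p G)

-- Vertices: Fin (3 + (j + (a + b))).
--   0                     : root v₀
--   1                     : child of the root with a leaf-children
--   2                     : child of the root with b leaf-children
--   3 … j+2               : the j leaf-children of the root
--   j+3 … j+a+2           : the a children of vertex 1
--   j+a+3 … j+a+b+2       : the b children of vertex 2
-- Edges: Fin (2 + (j + (a + b))); edge i joins vertex i+1 to its parent.
RT-parent : (j a b : ℕ) → Fin (2 + (j + (a + b))) → Fin (3 + (j + (a + b)))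
RT-parent j a b i =
  if toℕ i <ᵇ 2 + j then Fin.zero
  else if toℕ i <ᵇ 2 + j + a then Fin.suc Fin.zero
  else Fin.suc (Fin.suc Fin.zero)

RT : (j a b : ℕ) → Graph
RT j a b = record
  { p    = 3 + (j + (a + b))
  ; q    = 2 + (j + (a + b))
  ; ends = λ i → Fin.suc i , RT-parent j a b i
  }

module Submission where

-- Write j = 2j'+1, a = 2a', b = 2b'+1 and n = j'+a'+b'.  The tree has 2N
-- edges and 2N+1 vertices, where N = n+2, so the edge labels must be
-- ±1, …, ±N and the vertex labels 0, ±1, …, ±N.  Let alt = -1, 1, -2, 2, …
-- enumerate ℤ∖{0}; its first 2N values are exactly the edge labels.  Edge i
-- (joining vertex i+1 to its parent) gets  F i = alt (σ i),  where σ fixes 0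
-- and rotates 1, …, 2N-1 by one place; in edge order the labels are
--   -1 (to v₁),  N (to v₂),  1, -2, 2, …, -(N-1), N-1,  -N.
-- Consecutive pairs -k, k cancel, so the root gets -1 + N + 1 = F 1, v₁ gets
-- F 0, v₂ gets N - N = 0 and each leaf gets the label of its edge.  Thus the
-- vertex labelling is the sequence 0, F 0, F 1, F 2, … with positions 0 and
-- 2 exchanged, a bijection onto {0, ±1, …, ±N}.

open import Defs
open import Data.Nat as ℕ using (ℕ; _≤_; zero; suc; _+_; _*_; _<_; z≤n; s≤s; z<s; _<ᵇ_; _≡ᵇ_; _<?_)
open import Data.Nat.Properties as ℕP using (+-suc)
import Data.Nat.Tactic.RingSolver as ℕSolver
open import Data.Nat.DivMod using (_/_; _%_; m*n/n≡m; +-distrib-/-∣ʳ; [m+kn]%n≡m%n)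
open import Data.Nat.Divisibility using (divides; divides-refl; n∣m⇒m%n≡0)
open import Data.Integer as ℤ using (ℤ; +_; -[1+_]; ∣_∣)
import Data.Integer.Properties as ℤP
import Data.Integer.Tactic.RingSolver as ℤSolver
open import Data.Fin as Fin using (Fin; toℕ; fromℕ<)
open import Data.Fin.Properties using (toℕ-injective; toℕ-fromℕ<; toℕ<n)
open import Data.Bool using (true; false; if_then_else_; _∨_)
open import Data.Bool.Properties using (if-cong; if-float; if-cong-else; ∨-zeroʳ)
open import Data.Product using (_×_; _,_; proj₁; proj₂; ∃)
open import Data.Sum using (_⊎_; inj₁; inj₂)
open import Data.Empty using (⊥-elim)
open import Function using (_∘_)
open import Function.Bundles using (_⇔_; mk⇔; Equivalence)
open import Function.Definitions using (Injective)
open import Relation.Nullary using (¬_; does; yes; no)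
open import Relation.Binary.PropositionalEquality hiding (J)

≡ᵇ-refl : ∀ n → (n ≡ᵇ n) ≡ true
≡ᵇ-refl zero    = refl
≡ᵇ-refl (suc n) = ≡ᵇ-refl n

≡ᵇ-≢ : ∀ {m n} → m ≢ n → (m ≡ᵇ n) ≡ false
≡ᵇ-≢ {zero}  {zero}  m≢n = ⊥-elim (m≢n refl)
≡ᵇ-≢ {zero}  {suc n} _   = refl
≡ᵇ-≢ {suc m} {zero}  _   = refl
≡ᵇ-≢ {suc m} {suc n} m≢n = ≡ᵇ-≢ (m≢n ∘ cong suc)

<ᵇ-true : ∀ {m n} → m < n → (m <ᵇ n) ≡ true
<ᵇ-true {zero}  {suc n} _         = refl
<ᵇ-true {suc m} {suc n} (s≤s m<n) = <ᵇ-true m<n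

<ᵇ-false : ∀ {m n} → n ≤ m → (m <ᵇ n) ≡ false
<ᵇ-false {m}     {zero}  _         = refl
<ᵇ-false {suc m} {suc n} (s≤s n≤m) = <ᵇ-false n≤m

does-≟ : ∀ {m} (x y : Fin m) → does (x Fin.≟ y) ≡ (toℕ x ≡ᵇ toℕ y)
does-≟ Fin.zero    Fin.zero    = refl
does-≟ Fin.zero    (Fin.suc y) = refl
does-≟ (Fin.suc x) Fin.zero    = refl
does-≟ (Fin.suc x) (Fin.suc y) = does-≟ x y

double : ∀ N → N * 2 ≡ N + N
double N = trans (ℕP.*-comm N 2) (cong (λ x → N + x) (ℕP.+-identityʳ N))

even-or-odd : ∀ m → (∃ λ k → m ≡ k + k) ⊎ (∃ λ k → m ≡ suc (k + k))
even-or-odd zero = inj₁ (0 , refl)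
even-or-odd (suc m) with even-or-odd m
... | inj₁ (k , m≡2k)   = inj₂ (k , cong suc m≡2k)
... | inj₂ (k , m≡2k+1) = inj₁ (suc k , trans (cong suc m≡2k+1) (cong suc (sym (+-suc k k))))

even-half : ∀ m → Even m → ∃ λ k → m ≡ k + k
even-half m (divides k m≡k*2) = k , trans m≡k*2 (double k)

odd-half : ∀ m → Odd m → ∃ λ k → m ≡ suc (k + k)
odd-half m m-odd with even-or-odd m
... | inj₁ (k , m≡2k) = ⊥-elim (m-odd (divides k (trans m≡2k (sym (double k)))))
... | inj₂ half       = half

odd-not-even : ∀ N → ¬ Even (suc (N + N))
odd-not-even N ev with trans (sym ([m+kn]%n≡m%n 1 N 2))
                             (trans (cong (λ x → suc x % 2) (double N)) (n∣m⇒m%n≡0 _ 2 ev))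
... | ()

half-even : ∀ N → (N + N) / 2 ≡ N
half-even N = trans (cong (_/ 2) (sym (double N))) (m*n/n≡m N 2)

half-odd : ∀ N → suc (N + N) / 2 ≡ N
half-odd N = trans (cong (λ x → suc x / 2) (sym (double N)))
                   (trans (+-distrib-/-∣ʳ 1 {d = 2} (divides-refl N)) (m*n/n≡m N 2))

NonzeroUpTo : ℕ → ℤ → Set
NonzeroUpTo N z = ∣ z ∣ ≤ N × z ≢ + 0

UpTo : ℕ → ℤ → Set
UpTo N z = ∣ z ∣ ≤ N

labels-even : ∀ {L} N → L ≡ N + N → ∀ z → InLabels L z ⇔ NonzeroUpTo N z
labels-even N refl z = mk⇔
  (λ (bound , nonzero) → subst (∣ z ∣ ≤_) (half-even N) bound , nonzero (divides N (sym (double N))))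
  (λ (bound , nonzero) → subst (∣ z ∣ ≤_) (sym (half-even N)) bound , λ _ → nonzero)

labels-odd : ∀ {L} N → L ≡ suc (N + N) → ∀ z → InLabels L z ⇔ UpTo N z
labels-odd N refl z = mk⇔
  (λ (bound , _) → subst (∣ z ∣ ≤_) (half-odd N) bound)
  (λ bound → subst (∣ z ∣ ≤_) (sym (half-odd N)) bound , λ ev → ⊥-elim (odd-not-even N ev))

record Enumerates (m : ℕ) (Lab : ℤ → Set) (P : ℕ → ℤ) : Set where
  field
    index    : ℤ → ℕ
    labelled : ∀ {i} → i < m → Lab (P i)
    index-<  : ∀ {z} → Lab z → index z < m
    index-P  : ∀ {i} → i < m → index (P i) ≡ i
    P-index  : ∀ {z} → Lab z → P (index z) ≡ z

enumerates⇒bij : ∀ {m L Lab P} → Enumerates m Lab P → (∀ z → InLabels L z ⇔ Lab z) →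
  IsBijOnto (λ (x : Fin m) → P (toℕ x)) L
enumerates⇒bij {m} {L} {Lab} {P} e labels = into , injective , onto
  where
  open Enumerates e

  into : ∀ x → InLabels L (P (toℕ x))
  into x = Equivalence.from (labels _) (labelled (toℕ<n x))

  injective : Injective _≡_ _≡_ (λ (x : Fin m) → P (toℕ x))
  injective {x} {y} Px≡Py = toℕ-injective (begin
    toℕ x               ≡⟨ sym (index-P (toℕ<n x)) ⟩
    index (P (toℕ x))   ≡⟨ cong index Px≡Py ⟩
    index (P (toℕ y))   ≡⟨ index-P (toℕ<n y) ⟩
    toℕ y               ∎)
    where open ≡-Reasoning

  onto : ∀ z → InLabels L z → ∃ λ x → P (toℕ x) ≡ z
  onto z z-label = fromℕ< (index-< lab) , trans (cong P (toℕ-fromℕ< (index-< lab))) (P-index lab)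
    where
    lab : Lab z
    lab = Equivalence.to (labels z) z-label

bij-pointwise : ∀ {m} {g h : Fin m → ℤ} {L} → IsBijOnto g L → (∀ x → h x ≡ g x) → IsBijOnto h L
bij-pointwise (into , injective , onto) h≗g =
  (λ x → subst (InLabels _) (sym (h≗g x)) (into x)) ,
  (λ {x} {y} hx≡hy → injective (trans (sym (h≗g x)) (trans hx≡hy (h≗g y)))) ,
  (λ z z-label → proj₁ (onto z z-label) , trans (h≗g _) (proj₂ (onto z z-label)))

record Permutation (m : ℕ) : Set where
  field
    to from : ℕ → ℕ
    to-<    : ∀ {i} → i < m → to i < m
    from-<  : ∀ {i} → i < m → from i < m
    from-to : ∀ {i} → i < m → from (to i) ≡ i
    to-from : ∀ {i} → i < m → to (from i) ≡ i

reindex : ∀ {m Lab P} (π : Permutation m) → Enumerates m Lab P →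
  Enumerates m Lab (P ∘ Permutation.to π)
reindex {P = P} π e = record
  { index    = from ∘ index
  ; labelled = λ i<m → labelled (to-< i<m)
  ; index-<  = λ lab → from-< (index-< lab)
  ; index-P  = λ i<m → trans (cong from (index-P (to-< i<m))) (from-to i<m)
  ; P-index  = λ lab → trans (cong P (to-from (index-< lab))) (P-index lab)
  }
  where
  open Permutation π
  open Enumerates e

rotate : ℕ → ℕ → ℕ
rotate m zero    = m
rotate m (suc i) = i

unrotate : ℕ → ℕ → ℕ
unrotate m i with i <? m
... | yes _ = suc i
... | no  _ = zero

unrotate-below : ∀ {m i} → i < m → unrotate m i ≡ suc i
unrotate-below {m} {i} i<m with i <? m
... | yes _   = refl
... | no  i≮m = ⊥-elim (i≮m i<m)

unrotate-top : ∀ m → unrotate m m ≡ zero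
unrotate-top m with m <? m
... | yes m<m = ⊥-elim (ℕP.<-irrefl refl m<m)
... | no  _   = refl

rotation : ∀ m → Permutation (suc m)
rotation m = record
  { to      = rotate m
  ; from    = unrotate m
  ; to-<    = to-<
  ; from-<  = from-<
  ; from-to = from-to
  ; to-from = to-from
  }
  where
  to-< : ∀ {i} → i < suc m → rotate m i < suc m
  to-< {zero}  _         = ℕP.n<1+n m
  to-< {suc i} (s≤s i<m) = ℕP.m≤n⇒m≤1+n i<m

  from-< : ∀ {i} → i < suc m → unrotate m i < suc m
  from-< {i} i≤m with i <? m
  ... | yes i<m = s≤s i<m
  ... | no  _   = z<s

  from-to : ∀ {i} → i < suc m → unrotate m (rotate m i) ≡ i
  from-to {zero}  _         = unrotate-top m
  from-to {suc i} (s≤s i<m) = unrotate-below i<m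

  to-from : ∀ {i} → i < suc m → rotate m (unrotate m i) ≡ i
  to-from {i} (s≤s i≤m) with i <? m
  ... | yes _   = refl
  ... | no  i≮m = ℕP.≤-antisym (ℕP.≮⇒≥ i≮m) i≤m

liftℕ : (ℕ → ℕ) → ℕ → ℕ
liftℕ f zero    = zero
liftℕ f (suc i) = suc (f i)

lift : ∀ {m} → Permutation m → Permutation (suc m)
lift {m} π = record
  { to      = liftℕ to
  ; from    = liftℕ from
  ; to-<    = lift-< to to-<
  ; from-<  = lift-< from from-<
  ; from-to = λ { {zero} _ → refl ; {suc i} (s≤s i<m) → cong suc (from-to i<m) }
  ; to-from = λ { {zero} _ → refl ; {suc i} (s≤s i<m) → cong suc (to-from i<m) }
  }
  where
  open Permutation π
  lift-< : (f : ℕ → ℕ) → (∀ {i} → i < m → f i < m) → ∀ {i} → i < suc m → liftℕ f i < suc m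
  lift-< f f-< {zero}  _         = z<s
  lift-< f f-< {suc i} (s≤s i<m) = s≤s (f-< i<m)

swap₀₂ : ℕ → ℕ
swap₀₂ 0 = 2
swap₀₂ 2 = 0
swap₀₂ i = i

swap₀₂-involutive : ∀ i → swap₀₂ (swap₀₂ i) ≡ i
swap₀₂-involutive 0                   = refl
swap₀₂-involutive 1                   = refl
swap₀₂-involutive 2                   = refl
swap₀₂-involutive (suc (suc (suc i))) = refl

swap₀₂-< : ∀ {m i} → i < 3 + m → swap₀₂ i < 3 + m
swap₀₂-< {m} {0}                 _   = s≤s (s≤s z<s)
swap₀₂-< {m} {1}                 i<m = i<m
swap₀₂-< {m} {2}                 _   = z<s
swap₀₂-< {m} {suc (suc (suc i))} i<m = i<m

transposition₀₂ : ∀ m → Permutation (3 + m)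
transposition₀₂ m = record
  { to      = swap₀₂
  ; from    = swap₀₂
  ; to-<    = swap₀₂-<
  ; from-<  = swap₀₂-<
  ; from-to = λ {i} _ → swap₀₂-involutive i
  ; to-from = λ {i} _ → swap₀₂-involutive i
  }

withZero : (ℕ → ℤ) → ℕ → ℤ
withZero P zero    = + 0
withZero P (suc i) = P i

withZero-index : (ℤ → ℕ) → ℤ → ℕ
withZero-index ι (+ zero)    = zero
withZero-index ι (+ suc k)   = suc (ι (+ suc k))
withZero-index ι (-[1+ k ])  = suc (ι -[1+ k ])

withZero-index-nonzero : ∀ ι {z} → z ≢ + 0 → withZero-index ι z ≡ suc (ι z)
withZero-index-nonzero ι {+ zero}   z≢0 = ⊥-elim (z≢0 refl)
withZero-index-nonzero ι {+ suc k}  _   = refl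
withZero-index-nonzero ι { -[1+ k ]} _   = refl

withZero-enum : ∀ {m N P} → Enumerates m (NonzeroUpTo N) P → Enumerates (suc m) (UpTo N) (withZero P)
withZero-enum {m} {N} {P} e = record
  { index    = withZero-index index
  ; labelled = labelled′
  ; index-<  = index-<′
  ; index-P  = index-P′
  ; P-index  = P-index′
  }
  where
  open Enumerates e

  labelled′ : ∀ {i} → i < suc m → UpTo N (withZero P i)
  labelled′ {zero}  _         = z≤n
  labelled′ {suc i} (s≤s i<m) = proj₁ (labelled i<m)

  index-<′ : ∀ {z} → UpTo N z → withZero-index index z < suc m
  index-<′ {z} bound with z ℤ.≟ + 0
  ... | yes refl = z<s
  ... | no  z≢0  = subst (_< suc m) (sym (withZero-index-nonzero index z≢0)) (s≤s (index-< (bound , z≢0)))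

  index-P′ : ∀ {i} → i < suc m → withZero-index index (withZero P i) ≡ i
  index-P′ {zero}  _         = refl
  index-P′ {suc i} (s≤s i<m) =
    trans (withZero-index-nonzero index (proj₂ (labelled i<m))) (cong suc (index-P i<m))

  P-index′ : ∀ {z} → UpTo N z → withZero P (withZero-index index z) ≡ z
  P-index′ {z} bound with z ℤ.≟ + 0
  ... | yes refl = refl
  ... | no  z≢0  = trans (cong (withZero P) (withZero-index-nonzero index z≢0)) (P-index (bound , z≢0))

away : ℤ → ℤ
away (+ k)      = + suc k
away -[1+ k ]   = -[1+ suc k ]

alt : ℕ → ℤ
alt zero          = -[1+ 0 ]
alt (suc zero)    = + 1
alt (suc (suc i)) = away (alt i)

alt-index : ℤ → ℕ
alt-index (+ zero)   = 0
alt-index (+ suc k)  = suc (k + k)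
alt-index -[1+ k ]   = k + k

alt-odd : ∀ k → alt (suc (k + k)) ≡ + suc k
alt-odd zero    = refl
alt-odd (suc k) rewrite +-suc k k = cong away (alt-odd k)

alt-even : ∀ k → alt (k + k) ≡ -[1+ k ]
alt-even zero    = refl
alt-even (suc k) rewrite +-suc k k = cong away (alt-even k)

alt-nonzero : ∀ i → alt i ≢ + 0
alt-nonzero zero          ()
alt-nonzero (suc zero)    ()
alt-nonzero (suc (suc i)) with alt i
... | + _      = λ ()
... | -[1+ _ ] = λ ()

alt-index-away : ∀ z → z ≢ + 0 → alt-index (away z) ≡ suc (suc (alt-index z))
alt-index-away (+ zero)  z≢0 = ⊥-elim (z≢0 refl)
alt-index-away (+ suc k) _   = cong suc (+-suc (suc k) k)
alt-index-away -[1+ k ]  _   = +-suc (suc k) k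

alt-index-alt : ∀ i → alt-index (alt i) ≡ i
alt-index-alt zero          = refl
alt-index-alt (suc zero)    = refl
alt-index-alt (suc (suc i)) =
  trans (alt-index-away (alt i) (alt-nonzero i)) (cong (suc ∘ suc) (alt-index-alt i))

alt-alt-index : ∀ z → z ≢ + 0 → alt (alt-index z) ≡ z
alt-alt-index (+ zero)  z≢0 = ⊥-elim (z≢0 refl)
alt-alt-index (+ suc k) _   = alt-odd k
alt-alt-index -[1+ k ]  _   = alt-even k

∣away∣ : ∀ z → z ≢ + 0 → ∣ away z ∣ ≡ suc ∣ z ∣
∣away∣ (+ zero)  z≢0 = ⊥-elim (z≢0 refl)
∣away∣ (+ suc k) _   = refl
∣away∣ -[1+ k ]  _   = refl

alt-bound : ∀ i N → i < N + N → ∣ alt i ∣ ≤ N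
alt-bound zero          (suc N) _ = s≤s z≤n
alt-bound (suc zero)    (suc N) _ = s≤s z≤n
alt-bound (suc (suc i)) (suc N) (s≤s i+2≤2N+1)
  rewrite ∣away∣ (alt i) (alt-nonzero i) | +-suc N N = s≤s (alt-bound i N (ℕP.≤-pred i+2≤2N+1))

alt-index-bound : ∀ z N → ∣ z ∣ ≤ N → z ≢ + 0 → alt-index z < N + N
alt-index-bound (+ zero)  N       _          z≢0 = ⊥-elim (z≢0 refl)
alt-index-bound (+ suc k) (suc N) (s≤s k≤N) _ rewrite +-suc N N = s≤s (s≤s (ℕP.+-mono-≤ k≤N k≤N))
alt-index-bound -[1+ k ]  (suc N) (s≤s k≤N) _ rewrite +-suc N N =
  s≤s (ℕP.m≤n⇒m≤1+n (ℕP.+-mono-≤ k≤N k≤N))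

alt-enum : ∀ N → Enumerates (N + N) (NonzeroUpTo N) alt
alt-enum N = record
  { index    = alt-index
  ; labelled = λ {i} i<2N → alt-bound i N i<2N , alt-nonzero i
  ; index-<  = λ {z} (bound , z≢0) → alt-index-bound z N bound z≢0
  ; index-P  = λ {i} _ → alt-index-alt i
  ; P-index  = λ {z} (_ , z≢0) → alt-alt-index z z≢0
  }

sumFrom : ℕ → ℕ → (ℕ → ℤ) → ℤ
sumFrom zero    s h = + 0
sumFrom (suc n) s h = h s ℤ.+ sumFrom n (suc s) h

sumFrom-shift : ∀ n s h → sumFrom n (suc s) h ≡ sumFrom n s (h ∘ suc)
sumFrom-shift zero    s h = refl
sumFrom-shift (suc n) s h = cong (ℤ._+_ (h (suc s))) (sumFrom-shift n (suc s) h)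

∑-sumFrom : ∀ n (g : Fin n → ℤ) h → (∀ e → g e ≡ h (toℕ e)) → ∑ n g ≡ sumFrom n 0 h
∑-sumFrom zero    g h g≗h = refl
∑-sumFrom (suc n) g h g≗h = cong₂ ℤ._+_ (g≗h Fin.zero)
  (trans (∑-sumFrom n (g ∘ Fin.suc) (h ∘ suc) (g≗h ∘ Fin.suc)) (sym (sumFrom-shift n 0 h)))

sumFrom-cong : ∀ n s {h g} → (∀ {i} → s ≤ i → i < s + n → h i ≡ g i) → sumFrom n s h ≡ sumFrom n s g
sumFrom-cong zero    s h≗g = refl
sumFrom-cong (suc n) s h≗g = cong₂ ℤ._+_
  (h≗g ℕP.≤-refl (ℕP.m<m+n s z<s))
  (sumFrom-cong n (suc s) (λ {i} s<i i<s+n → h≗g (ℕP.<⇒≤ s<i) (subst (i <_) (sym (+-suc s n)) i<s+n)))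

sumFrom-zero : ∀ n s {h} → (∀ {i} → s ≤ i → i < s + n → h i ≡ + 0) → sumFrom n s h ≡ + 0
sumFrom-zero n s h≗0 = trans (sumFrom-cong n s h≗0) (zeros n s)
  where
  zeros : ∀ n s → sumFrom n s (λ _ → + 0) ≡ + 0
  zeros zero    s = refl
  zeros (suc n) s = trans (ℤP.+-identityˡ _) (zeros n (suc s))

sumFrom-++ : ∀ m n s h → sumFrom (m + n) s h ≡ sumFrom m s h ℤ.+ sumFrom n (s + m) h
sumFrom-++ zero    n s h rewrite ℕP.+-identityʳ s = sym (ℤP.+-identityˡ _)
sumFrom-++ (suc m) n s h rewrite +-suc s m =
  trans (cong (ℤ._+_ (h s)) (sumFrom-++ m n (suc s) h)) (sym (ℤP.+-assoc (h s) _ _))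

sumFrom-snoc : ∀ n s h → sumFrom (suc n) s h ≡ sumFrom n s h ℤ.+ h (s + n)
sumFrom-snoc n s h = trans (cong (λ k → sumFrom k s h) (ℕP.+-comm 1 n))
  (trans (sumFrom-++ n 1 s h) (cong (ℤ._+_ (sumFrom n s h)) (ℤP.+-identityʳ _)))

sumFrom-single : ∀ n s t h → s ≤ t → t < s + n → (∀ i → i ≢ t → h i ≡ + 0) → sumFrom n s h ≡ h t
sumFrom-single zero s t h s≤t t<s+0 _ =
  ⊥-elim (ℕP.<⇒≱ t<s+0 (subst (_≤ t) (sym (ℕP.+-identityʳ s)) s≤t))
sumFrom-single (suc n) s t h s≤t t<s+n others with s ℕ.≟ t
... | yes refl = trans (cong (ℤ._+_ (h s)) (sumFrom-zero n (suc s) (λ s<i _ → others _ (ℕP.<⇒≢ s<i ∘ sym))))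
                       (ℤP.+-identityʳ _)
... | no  s≢t  = trans (cong₂ ℤ._+_ (others s s≢t)
                         (sumFrom-single n (suc s) t h (ℕP.≤∧≢⇒< s≤t s≢t) (subst (t <_) (+-suc s n) t<s+n) others))
                       (ℤP.+-identityˡ _)

alt-pairs : ∀ m s → sumFrom (m + m) (s + s) alt ≡ + 0
alt-pairs zero    s = refl
alt-pairs (suc m) s = begin
  sumFrom (suc m + suc m) (s + s) alt
    ≡⟨ cong (λ k → sumFrom (suc k) (s + s) alt) (+-suc m m) ⟩
  alt (s + s) ℤ.+ (alt (suc (s + s)) ℤ.+ sumFrom (m + m) (suc (suc (s + s))) alt)
    ≡⟨ cong₂ (λ x y → x ℤ.+ (alt (suc (s + s)) ℤ.+ y)) (alt-even s)
             (trans (cong (λ t → sumFrom (m + m) (suc t) alt) (sym (+-suc s s))) (alt-pairs m (suc s))) ⟩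
  -[1+ s ] ℤ.+ (alt (suc (s + s)) ℤ.+ + 0)
    ≡⟨ cong (ℤ._+_ -[1+ s ]) (trans (ℤP.+-identityʳ _) (alt-odd s)) ⟩
  -[1+ s ] ℤ.+ + suc s
    ≡⟨ ℤP.+-inverseˡ (+ suc s) ⟩
  + 0 ∎
  where open ≡-Reasoning

module Incidence (j a b : ℕ) (F : ℕ → ℤ) where

  parent : ℕ → ℕ
  parent i = if i <ᵇ 2 + j then 0 else if i <ᵇ 2 + j + a then 1 else 2

  contribution : ℕ → ℕ → ℤ
  contribution w i = if (suc i ≡ᵇ w) ∨ (parent i ≡ᵇ w) then F i else + 0

  toℕ-RT-parent : ∀ e → toℕ (RT-parent j a b e) ≡ parent (toℕ e)
  toℕ-RT-parent e = trans (if-float toℕ (toℕ e <ᵇ 2 + j)) (if-cong-else (toℕ e <ᵇ 2 + j) (if-float toℕ (toℕ e <ᵇ 2 + j + a)))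

  induced-RT : ∀ v → induced (RT j a b) (F ∘ toℕ) v ≡ sumFrom (2 + (j + (a + b))) 0 (contribution (toℕ v))
  induced-RT v = ∑-sumFrom _ _ (contribution (toℕ v)) λ e → cong (λ c → if c then F (toℕ e) else + 0)
    (cong₂ _∨_ (does-≟ (Fin.suc e) v)
               (trans (does-≟ (RT-parent j a b e) v) (cong (_≡ᵇ toℕ v) (toℕ-RT-parent e))))

  parent-root : ∀ {i} → i < 2 + j → parent i ≡ 0
  parent-root i<2+j = if-cong (<ᵇ-true i<2+j)

  parent-v₁ : ∀ {i} → 2 + j ≤ i → i < 2 + j + a → parent i ≡ 1
  parent-v₁ 2+j≤i i<2+j+a = trans (if-cong (<ᵇ-false 2+j≤i)) (if-cong (<ᵇ-true i<2+j+a))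

  parent-v₂ : ∀ {i} → 2 + j + a ≤ i → parent i ≡ 2
  parent-v₂ 2+j+a≤i =
    trans (if-cong (<ᵇ-false (ℕP.≤-trans (ℕP.m≤m+n (2 + j) a) 2+j+a≤i))) (if-cong (<ᵇ-false 2+j+a≤i))

  parent-≤2 : ∀ i → parent i ≤ 2
  parent-≤2 i = bound (i <ᵇ 2 + j) (i <ᵇ 2 + j + a)
    where
    bound : ∀ b c → (if b then 0 else if c then 1 else 2) ≤ 2
    bound true  _     = z≤n
    bound false true  = s≤s z≤n
    bound false false = s≤s (s≤s z≤n)

  owned-block : ∀ {w} n s → (∀ {i} → s ≤ i → i < s + n → parent i ≡ w) →
    sumFrom n s (contribution w) ≡ sumFrom n s F
  owned-block {w} n s from-w = sumFrom-cong n s λ {i} s≤i i<s+n →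
    if-cong (trans (cong (λ c → (suc i ≡ᵇ w) ∨ (c ≡ᵇ w)) (from-w s≤i i<s+n))
                   (trans (cong ((suc i ≡ᵇ w) ∨_) (≡ᵇ-refl w)) (∨-zeroʳ _)))

  foreign-block : ∀ {w c} n s → w ≤ 2 → 2 ≤ s → c ≢ w → (∀ {i} → s ≤ i → i < s + n → parent i ≡ c) →
    sumFrom n s (contribution w) ≡ + 0
  foreign-block {w} {c} n s w≤2 2≤s c≢w from-c = sumFrom-zero n s λ {i} s≤i i<s+n →
    if-cong (cong₂ _∨_ (≡ᵇ-≢ (λ i+1≡w → ℕP.<⇒≱ (s≤s (ℕP.≤-trans 2≤s s≤i)) (ℕP.≤-trans (ℕP.≤-reflexive i+1≡w) w≤2)))
                       (trans (cong (_≡ᵇ w) (from-c s≤i i<s+n)) (≡ᵇ-≢ c≢w)))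

  leaf-sum : ∀ k → 2 + k < 2 + (j + (a + b)) → sumFrom (2 + (j + (a + b))) 0 (contribution (3 + k)) ≡ F (2 + k)
  leaf-sum k 2+k<q = trans (sumFrom-single _ 0 (2 + k) _ z≤n 2+k<q others)
                           (if-cong (cong (λ c → c ∨ (parent (2 + k) ≡ᵇ 3 + k)) (≡ᵇ-refl k)))
    where
    others : ∀ i → i ≢ 2 + k → contribution (3 + k) i ≡ + 0
    others i i≢2+k = if-cong (cong₂ _∨_ (≡ᵇ-≢ (i≢2+k ∘ ℕP.suc-injective))
      (≡ᵇ-≢ (λ parent≡3+k → ℕP.<⇒≱ (s≤s (s≤s (s≤s z≤n))) (subst (_≤ 2) parent≡3+k (parent-≤2 i)))))

module Labelling (j' a' b' : ℕ) where

  J A B n N #edges : ℕ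
  J      = suc (j' + j')
  A      = a' + a'
  B      = suc (b' + b')
  n      = j' + (a' + b')
  N      = suc (suc n)
  #edges = 2 + (J + (A + B))

  #edges≡2N : #edges ≡ N + N
  #edges≡2N = lemma j' a' b'
    where
    lemma : ∀ x y z → 2 + (suc (x + x) + ((y + y) + suc (z + z))) ≡ (2 + (x + (y + z))) + (2 + (x + (y + z)))
    lemma = ℕSolver.solve-∀

  σ : Permutation #edges
  σ = lift (rotation (J + (A + B)))

  F : ℕ → ℤ
  F = alt ∘ Permutation.to σ

  open Incidence J A B F

  V : ℕ → ℤ
  V = withZero F ∘ swap₀₂

  edges-enum : Enumerates #edges (NonzeroUpTo N) F
  edges-enum = reindex σ (subst (λ m → Enumerates m (NonzeroUpTo N) alt) (sym #edges≡2N) (alt-enum N))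

  vertices-enum : Enumerates (suc #edges) (UpTo N) V
  vertices-enum = reindex (transposition₀₂ _) (withZero-enum edges-enum)

  F-shift : ∀ len s → sumFrom len (suc (suc s)) F ≡ sumFrom len (suc s) alt
  F-shift len s = trans (sumFrom-shift len (suc s) F)
    (trans (sumFrom-shift len s (F ∘ suc)) (sym (sumFrom-shift len s alt)))

  F-1 : F 1 ≡ + N
  F-1 = trans (cong (alt ∘ suc) J+A+B≡) (alt-odd (suc n))
    where
    J+A+B≡ : J + (A + B) ≡ suc n + suc n
    J+A+B≡ = lemma j' a' b'
      where
      lemma : ∀ x y z → suc (x + x) + ((y + y) + suc (z + z)) ≡ suc (x + (y + z)) + suc (x + (y + z))
      lemma = ℕSolver.solve-∀

  root-leaves : sumFrom J 2 F ≡ + 1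
  root-leaves = trans (F-shift J 0) (cong (ℤ._+_ (+ 1)) (alt-pairs j' 1))

  v₁-leaves : sumFrom A (2 + J) F ≡ + 0
  v₁-leaves = trans (F-shift A J) (trans (cong (λ s → sumFrom A s alt) (cong suc (sym (+-suc j' j')))) (alt-pairs a' (suc j')))

  v₂-leaves : sumFrom B (2 + J + A) F ≡ -[1+ suc n ]
  v₂-leaves = begin
    sumFrom B (2 + J + A) F
      ≡⟨ F-shift B (J + A) ⟩
    sumFrom (suc (b' + b')) (suc (J + A)) alt
      ≡⟨ sumFrom-snoc (b' + b') (suc (J + A)) alt ⟩
    sumFrom (b' + b') (suc (J + A)) alt ℤ.+ alt (suc (J + A) + (b' + b'))
      ≡⟨ cong₂ ℤ._+_ (trans (cong (λ s → sumFrom (b' + b') s alt) start≡) (alt-pairs b' (suc (j' + a'))))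
                     (trans (cong alt end≡) (alt-even (suc n))) ⟩
    + 0 ℤ.+ -[1+ suc n ]
      ≡⟨ ℤP.+-identityˡ _ ⟩
    -[1+ suc n ] ∎
    where
    open ≡-Reasoning
    start≡ : suc (J + A) ≡ suc (j' + a') + suc (j' + a')
    start≡ = lemma j' a'
      where
      lemma : ∀ x y → suc (suc (x + x) + (y + y)) ≡ suc (x + y) + suc (x + y)
      lemma = ℕSolver.solve-∀
    end≡ : suc (J + A) + (b' + b') ≡ suc n + suc n
    end≡ = lemma j' a' b'
      where
      lemma : ∀ x y z → suc (suc (x + x) + (y + y)) + (z + z) ≡ suc (x + (y + z)) + suc (x + (y + z))
      lemma = ℕSolver.solve-∀

  vertex-split : ∀ h → sumFrom #edges 0 h ≡ h 0 ℤ.+ (h 1 ℤ.+ (sumFrom J 2 h ℤ.+ (sumFrom A (2 + J) h ℤ.+ sumFrom B (2 + J + A) h)))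
  vertex-split h = cong (λ x → h 0 ℤ.+ (h 1 ℤ.+ x))
    (trans (sumFrom-++ J (A + B) 2 h) (cong (ℤ._+_ (sumFrom J 2 h)) (sumFrom-++ A B (2 + J) h)))

  root-block : ∀ {i} → 2 ≤ i → i < 2 + J → parent i ≡ 0
  root-block _ = parent-root

  v₂-block : ∀ {i} → 2 + J + A ≤ i → i < 2 + J + A + B → parent i ≡ 2
  v₂-block 2+J+A≤i _ = parent-v₂ 2+J+A≤i

  2≤2+ : ∀ k → 2 ≤ 2 + k
  2≤2+ _ = s≤s (s≤s z≤n)

  root-label : sumFrom #edges 0 (contribution 0) ≡ V 0
  root-label = begin
    sumFrom #edges 0 (contribution 0)
      ≡⟨ vertex-split (contribution 0) ⟩
    F 0 ℤ.+ (F 1 ℤ.+ (sumFrom J 2 (contribution 0) ℤ.+ (sumFrom A (2 + J) (contribution 0) ℤ.+ sumFrom B (2 + J + A) (contribution 0))))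
      ≡⟨ cong (λ x → F 0 ℤ.+ (F 1 ℤ.+ x)) (cong₂ ℤ._+_ (trans (owned-block J 2 root-block) root-leaves)
           (cong₂ ℤ._+_ (foreign-block A (2 + J) z≤n (2≤2+ J) (λ ()) parent-v₁)
                        (foreign-block B (2 + J + A) z≤n (2≤2+ (J + A)) (λ ()) v₂-block))) ⟩
    -[1+ 0 ] ℤ.+ (F 1 ℤ.+ (+ 1 ℤ.+ (+ 0 ℤ.+ + 0)))
      ≡⟨ cancel (F 1) ⟩
    F 1 ∎
    where
    open ≡-Reasoning
    cancel : ∀ x → ℤ.- ℤ.1ℤ ℤ.+ (x ℤ.+ (ℤ.1ℤ ℤ.+ (ℤ.0ℤ ℤ.+ ℤ.0ℤ))) ≡ x
    cancel = ℤSolver.solve-∀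

  v₁-label : sumFrom #edges 0 (contribution 1) ≡ V 1
  v₁-label = begin
    sumFrom #edges 0 (contribution 1)
      ≡⟨ vertex-split (contribution 1) ⟩
    F 0 ℤ.+ (+ 0 ℤ.+ (sumFrom J 2 (contribution 1) ℤ.+ (sumFrom A (2 + J) (contribution 1) ℤ.+ sumFrom B (2 + J + A) (contribution 1))))
      ≡⟨ cong (λ x → F 0 ℤ.+ (+ 0 ℤ.+ x)) (cong₂ ℤ._+_ (foreign-block J 2 (s≤s z≤n) ℕP.≤-refl (λ ()) root-block)
           (cong₂ ℤ._+_ (trans (owned-block A (2 + J) parent-v₁) v₁-leaves)
                        (foreign-block B (2 + J + A) (s≤s z≤n) (2≤2+ (J + A)) (λ ()) v₂-block))) ⟩
    F 0 ℤ.+ (+ 0 ℤ.+ (+ 0 ℤ.+ (+ 0 ℤ.+ + 0)))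
      ≡⟨ ℤP.+-identityʳ (F 0) ⟩
    F 0 ∎
    where open ≡-Reasoning

  v₂-label : sumFrom #edges 0 (contribution 2) ≡ V 2
  v₂-label = begin
    sumFrom #edges 0 (contribution 2)
      ≡⟨ vertex-split (contribution 2) ⟩
    + 0 ℤ.+ (F 1 ℤ.+ (sumFrom J 2 (contribution 2) ℤ.+ (sumFrom A (2 + J) (contribution 2) ℤ.+ sumFrom B (2 + J + A) (contribution 2))))
      ≡⟨ cong₂ (λ x y → + 0 ℤ.+ (x ℤ.+ y)) F-1
           (cong₂ ℤ._+_ (foreign-block J 2 ℕP.≤-refl ℕP.≤-refl (λ ()) root-block)
             (cong₂ ℤ._+_ (foreign-block A (2 + J) ℕP.≤-refl (2≤2+ J) (λ ()) parent-v₁)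
                          (trans (owned-block B (2 + J + A) v₂-block) v₂-leaves))) ⟩
    + 0 ℤ.+ (+ N ℤ.+ (+ 0 ℤ.+ (+ 0 ℤ.+ ℤ.- (+ N))))
      ≡⟨ cancel (+ N) ⟩
    + 0 ∎
    where
    open ≡-Reasoning
    cancel : ∀ x → ℤ.0ℤ ℤ.+ (x ℤ.+ (ℤ.0ℤ ℤ.+ (ℤ.0ℤ ℤ.+ ℤ.- x))) ≡ ℤ.0ℤ
    cancel = ℤSolver.solve-∀

  vertex-label : ∀ w → w < suc #edges → sumFrom #edges 0 (contribution w) ≡ V w
  vertex-label 0                   _   = root-label
  vertex-label 1                   _   = v₁-label
  vertex-label 2                   _   = v₂-label
  vertex-label (suc (suc (suc k))) w<p = leaf-sum k (ℕP.≤-pred w<p)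

  graceful : SuperEdgeGraceful (RT J A B)
  graceful = F ∘ toℕ ,
    enumerates⇒bij edges-enum (labels-even N #edges≡2N) ,
    bij-pointwise (enumerates⇒bij vertices-enum (labels-odd N (cong suc #edges≡2N)))
                  (λ v → trans (induced-RT v) (vertex-label (toℕ v) (toℕ<n v)))

-- The main theorem.
lemma2 : (j a b : ℕ) → Odd j → 1 ≤ j → Even a → 2 ≤ a → Odd b → 1 ≤ b →
    SuperEdgeGraceful (RT j a b)
lemma2 j a b j-odd _ a-even _ b-odd _
  with odd-half j j-odd | even-half a a-even | odd-half b b-odd
... | j' , refl | a' , refl | b' , refl = Labelling.graceful j' a' b'
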